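{- Let $p$ and $l_2$ be distinct primes, let $l_1$ be a positive integer with $p\nmid l_1$, and let $s\geq 0$ be such that $l_2^s$ exactly divides $l_1$. Let $G=P\rtimes\mathbb{Z}/(l_1l_2)$ be a semidirect product of a $p$-group $P$ by the cyclic group $\mathbb{Z}/(l_1l_2)$. Suppose $G$ has a normal subgroup $N\cong\mathbb{Z}/l_2^{s+1}$ with $G/N\cong\mathbb{Z}/(l_1l_2^{ -s}p^m)$ for some $m\geq 0$. Then $G\cong\mathbb{Z}/p^m\times\mathbb{Z}/(l_1l_2)$. -}

module Defs where

open import Level using (Level; _⊔_; 0ℓ; suc)
open import Data.Product using (Σ; ∃; _×_; _,_; proj₁; proj₂)
open import Data.Nat.Base as ℕ using (ℕ; _^_)
open import Data.Nat.Primality using (Prime)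
open import Data.Fin.Base using (Fin)
open import Data.Integer.Base as ℤ using (ℤ; +_)
import Data.Integer.Properties as ℤP
open import Data.Integer.Divisibility.Signed as ℤD using ()
open import Algebra.Bundles using (Group; AbelianGroup)
open import Algebra.Morphism.Structures using (module GroupMorphisms)
import Algebra.Construct.DirectProduct as DP
import Algebra.Properties.Group as GroupProps
open import Relation.Unary using (Pred)
open import Relation.Binary.PropositionalEquality as ≡ using (_≡_)
import Relation.Binary.Reasoning.Setoid as SetoidReasoning

private
  variable
    a b ℓ₁ ℓ₂ ℓ : Level

_≅_ : Group a ℓ₁ → Group b ℓ₂ → Set (a ⊔ b ⊔ ℓ₁ ⊔ ℓ₂)
G ≅ H = Σ (Group.Carrier G → Group.Carrier H)
          (GroupMorphisms.IsGroupIsomorphism (Group.rawGroup G) (Group.rawGroup H))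

HasOrder : Group a ℓ₁ → ℕ → Set (a ⊔ ℓ₁)
HasOrder G n =
  Σ (Fin n → Carrier) λ f →
    (∀ i j → f i ≈ f j → i ≡ j) × (∀ x → ∃ λ i → f i ≈ x)
  where open Group G

IsPGroup : ℕ → Group a ℓ₁ → Set (a ⊔ ℓ₁)
IsPGroup p G = ∃ λ k → HasOrder G (p ^ k)

record IsSubgroup (G : Group a ℓ₁) (S : Pred (Group.Carrier G) ℓ) : Set (a ⊔ ℓ₁ ⊔ ℓ) where
  open Group G
  field
    resp : ∀ {x y} → x ≈ y → S x → S y
    ε∈   : S ε
    ∙∈   : ∀ {x y} → S x → S y → S (x ∙ y)
    ⁻¹∈  : ∀ {x} → S x → S (x ⁻¹)

record IsNormalSubgroup (G : Group a ℓ₁) (N : Pred (Group.Carrier G) ℓ) : Set (a ⊔ ℓ₁ ⊔ ℓ) where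
  open Group G
  field
    isSubgroup : IsSubgroup G N
    conj∈      : ∀ g {x} → N x → N ((g ∙ x) ∙ g ⁻¹)
  open IsSubgroup isSubgroup public

subgroup : (G : Group a ℓ₁) {S : Pred (Group.Carrier G) ℓ} → IsSubgroup G S →
           Group (a ⊔ ℓ) ℓ₁
subgroup G {S} sub = record
  { Carrier = Σ Carrier S
  ; _≈_     = λ x y → proj₁ x ≈ proj₁ y
  ; _∙_     = λ x y → (proj₁ x ∙ proj₁ y) , ∙∈ (proj₂ x) (proj₂ y)
  ; ε       = ε , ε∈
  ; _⁻¹     = λ x → (proj₁ x ⁻¹) , ⁻¹∈ (proj₂ x)
  ; isGroup = record
    { isMonoid = record
      { isSemigroup = record
        { isMagma = record
          { isEquivalence = record { refl = refl ; sym = sym ; trans = trans }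
          ; ∙-cong = ∙-cong
          }
        ; assoc = λ x y z → assoc (proj₁ x) (proj₁ y) (proj₁ z)
        }
      ; identity = (λ x → identityˡ (proj₁ x)) , (λ x → identityʳ (proj₁ x))
      }
    ; inverse = (λ x → inverseˡ (proj₁ x)) , (λ x → inverseʳ (proj₁ x))
    ; ⁻¹-cong = ⁻¹-cong
    }
  }
  where open Group G; open IsSubgroup sub

quotient : (G : Group a ℓ₁) {N : Pred (Group.Carrier G) ℓ} → IsNormalSubgroup G N →
           Group a ℓ
quotient G {N} nor = record
  { Carrier = Carrier
  ; _≈_     = _~_
  ; _∙_     = _∙_
  ; ε       = ε
  ; _⁻¹     = _⁻¹
  ; isGroup = record
    { isMonoid = record
      { isSemigroup = record
        { isMagma = record
          { isEquivalence = record { refl = ~-refl ; sym = ~-sym ; trans = ~-trans }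
          ; ∙-cong = ~-∙-cong
          }
        ; assoc = λ x y z → ≈⇒~ (assoc x y z)
        }
      ; identity = (λ x → ≈⇒~ (identityˡ x)) , (λ x → ≈⇒~ (identityʳ x))
      }
    ; inverse = (λ x → ≈⇒~ (inverseˡ x)) , (λ x → ≈⇒~ (inverseʳ x))
    ; ⁻¹-cong = ~-⁻¹-cong
    }
  }
  where
  open Group G
  open IsNormalSubgroup nor
  open GroupProps G
  open SetoidReasoning setoid

  _~_ : Carrier → Carrier → Set _
  x ~ y = N (x ∙ y ⁻¹)

  ≈⇒~ : ∀ {x y} → x ≈ y → x ~ y
  ≈⇒~ x≈y = resp (sym (x≈y⇒x∙y⁻¹≈ε x≈y)) ε∈

  ~-refl : ∀ {x} → x ~ x
  ~-refl = ≈⇒~ refl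

  ~-sym : ∀ {x y} → x ~ y → y ~ x
  ~-sym {x} {y} n = resp eq (⁻¹∈ n)
    where
    eq : (x ∙ y ⁻¹) ⁻¹ ≈ y ∙ x ⁻¹
    eq = begin
      (x ∙ y ⁻¹) ⁻¹      ≈⟨ ⁻¹-anti-homo-∙ x (y ⁻¹) ⟩
      y ⁻¹ ⁻¹ ∙ x ⁻¹     ≈⟨ ∙-congʳ (⁻¹-involutive y) ⟩
      y ∙ x ⁻¹           ∎

  cancel : ∀ x y z → (x ∙ y ⁻¹) ∙ (y ∙ z) ≈ x ∙ z
  cancel x y z = begin
    (x ∙ y ⁻¹) ∙ (y ∙ z)   ≈⟨ assoc x (y ⁻¹) (y ∙ z) ⟩
    x ∙ (y ⁻¹ ∙ (y ∙ z))   ≈⟨ ∙-congˡ (sym (assoc (y ⁻¹) y z)) ⟩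
    x ∙ ((y ⁻¹ ∙ y) ∙ z)   ≈⟨ ∙-congˡ (∙-congʳ (inverseˡ y)) ⟩
    x ∙ (ε ∙ z)            ≈⟨ ∙-congˡ (identityˡ z) ⟩
    x ∙ z                  ∎

  ~-trans : ∀ {x y z} → x ~ y → y ~ z → x ~ z
  ~-trans {x} {y} {z} n m = resp (cancel x y (z ⁻¹)) (∙∈ n m)

  ~-∙-cong : ∀ {x y u v} → x ~ y → u ~ v → (x ∙ u) ~ (y ∙ v)
  ~-∙-cong {x} {y} {u} {v} n m = resp eq (∙∈ (conj∈ x m) n)
    where
    eq : ((x ∙ (u ∙ v ⁻¹)) ∙ x ⁻¹) ∙ (x ∙ y ⁻¹) ≈ (x ∙ u) ∙ (y ∙ v) ⁻¹
    eq = begin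
      ((x ∙ (u ∙ v ⁻¹)) ∙ x ⁻¹) ∙ (x ∙ y ⁻¹) ≈⟨ cancel (x ∙ (u ∙ v ⁻¹)) x (y ⁻¹) ⟩
      (x ∙ (u ∙ v ⁻¹)) ∙ y ⁻¹                 ≈⟨ ∙-congʳ (sym (assoc x u (v ⁻¹))) ⟩
      ((x ∙ u) ∙ v ⁻¹) ∙ y ⁻¹                 ≈⟨ assoc (x ∙ u) (v ⁻¹) (y ⁻¹) ⟩
      (x ∙ u) ∙ (v ⁻¹ ∙ y ⁻¹)                 ≈⟨ ∙-congˡ (sym (⁻¹-anti-homo-∙ y v)) ⟩
      (x ∙ u) ∙ (y ∙ v) ⁻¹                    ∎

  ~-⁻¹-cong : ∀ {x y} → x ~ y → (x ⁻¹) ~ (y ⁻¹)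
  ~-⁻¹-cong {x} {y} n = resp eq (conj∈ (x ⁻¹) (~-sym n))
    where
    eq : ((x ⁻¹ ∙ (y ∙ x ⁻¹)) ∙ x ⁻¹ ⁻¹) ≈ x ⁻¹ ∙ y ⁻¹ ⁻¹
    eq = begin
      (x ⁻¹ ∙ (y ∙ x ⁻¹)) ∙ x ⁻¹ ⁻¹   ≈⟨ ∙-congˡ (⁻¹-involutive x) ⟩
      (x ⁻¹ ∙ (y ∙ x ⁻¹)) ∙ x         ≈⟨ assoc (x ⁻¹) (y ∙ x ⁻¹) x ⟩
      x ⁻¹ ∙ ((y ∙ x ⁻¹) ∙ x)         ≈⟨ ∙-congˡ (assoc y (x ⁻¹) x) ⟩
      x ⁻¹ ∙ (y ∙ (x ⁻¹ ∙ x))         ≈⟨ ∙-congˡ (∙-congˡ (inverseˡ x)) ⟩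
      x ⁻¹ ∙ (y ∙ ε)                  ≈⟨ ∙-congˡ (identityʳ y) ⟩
      x ⁻¹ ∙ y                        ≈⟨ ∙-congˡ (sym (⁻¹-involutive y)) ⟩
      x ⁻¹ ∙ y ⁻¹ ⁻¹                  ∎

ℤ-group : Group 0ℓ 0ℓ
ℤ-group = AbelianGroup.group ℤP.+-0-abelianGroup

multiplesOf : ℕ → Pred ℤ 0ℓ
multiplesOf n x = (+ n) ℤD.∣ x

multiplesOf-normal : ∀ n → IsNormalSubgroup ℤ-group (multiplesOf n)
multiplesOf-normal n = record
  { isSubgroup = record
    { resp = λ { ≡.refl m → m }
    ; ε∈   = ℤD.divides (+ 0) ≡.refl
    ; ∙∈   = ℤD.∣m∣n⇒∣m+n
    ; ⁻¹∈  = ℤD.∣m⇒∣-m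
    }
  ; conj∈ = λ g {x} m → ≡.subst (multiplesOf n) (eq g x) m
  }
  where
  eq : ∀ g x → x ≡ (g ℤ.+ x) ℤ.+ ℤ.- g
  eq g x = ≡.sym (≡.trans (≡.cong (ℤ._+ ℤ.- g) (ℤP.+-comm g x))
                 (≡.trans (ℤP.+-assoc x g (ℤ.- g))
                 (≡.trans (≡.cong (λ y → x ℤ.+ y) (ℤP.+-inverseʳ g)) (ℤP.+-identityʳ x))))

-- The cyclic group ℤ/n (used for n > 0).
ℤ/ : ℕ → Group 0ℓ 0ℓ
ℤ/ n = quotient ℤ-group (multiplesOf-normal n)

_×ᴳ_ : Group a ℓ₁ → Group b ℓ₂ → Group (a ⊔ b) (ℓ₁ ⊔ ℓ₂)
G ×ᴳ H = DP.group G H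

IsSemidirectProduct : (G : Group a ℓ₁) → Group b ℓ₂ → Group b ℓ₂ →
                      Set (suc (a ⊔ ℓ₁) ⊔ b ⊔ ℓ₂)
IsSemidirectProduct {a} {ℓ₁} G P C =
  Σ (Pred Carrier (a ⊔ ℓ₁)) λ K → Σ (Pred Carrier (a ⊔ ℓ₁)) λ H →
  Σ (IsNormalSubgroup G K) λ Knor → Σ (IsSubgroup G H) λ Hsub →
    (subgroup G (IsNormalSubgroup.isSubgroup Knor) ≅ P) ×
    (subgroup G Hsub ≅ C) ×
    (∀ x → K x → H x → x ≈ ε) ×
    (∀ g → ∃ λ k → ∃ λ h → K k × H h × g ≈ k ∙ h)
  where open Group G

-- Write G = K ⋊ H with K ≅ P and θ : H ≅ ℤ/l₁l₂, and let ψ : G → G/N ≅ ℤ/M, where M = q pᵐ and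
-- q = l₁ / l₂ˢ.  As p ∤ l₁l₂, ψ vanishes on H modulo pᵐ.  The elements θ⁻¹(q z) lie in N, and they
-- exhaust the cyclic group N because θ⁻¹(q l₂ˢ) = θ⁻¹(l₁) ≠ 1; hence N ⊆ H.  Since G/N is abelian,
-- every commutator [k, h] lies in K ∩ N ⊆ K ∩ H = 1, so K and H commute.  Finally |K| is a power of
-- p, so q divides ψ(K), and g ↦ (ψ g mod pᵐ, θ(h-part of g)) is an isomorphism G ≅ ℤ/pᵐ × ℤ/l₁l₂.
module Submission where

open import Defs
open import Level using (Level; 0ℓ)
open import Function using (_∘_; id)
open import Function.Definitions using (Surjective)
open import Data.Product using (Σ; ∃; _×_; _,_; proj₁; proj₂; <_,_>)
open import Data.Sum using (inj₁; inj₂)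
open import Data.Empty using (⊥-elim)
open import Data.Nat.Base as ℕ using (ℕ; zero; suc; _^_; _<_)
import Data.Nat.Properties as ℕP
open import Data.Nat.Divisibility as ℕD using () renaming (_∣_ to _∣ℕ_)
open import Data.Nat.Coprimality as Coprimality using (Coprime; coprime-divisor; coprime-Bézout)
open import Data.Nat.GCD using (module Bézout)
open import Data.Nat.Primality using (Prime; prime⇒irreducible; ¬prime[1])
open import Data.Integer.Base as ℤ using (ℤ; +_; -[1+_]; _+_; _*_; -_; _-_; ∣_∣; 0ℤ; 1ℤ)
import Data.Integer.Properties as ℤP
open import Data.Integer.Divisibility.Signed using (_∣_; divides; ∣ᵤ⇒∣; ∣⇒∣ᵤ; ∣-refl; ∣-trans; ∣m∣n⇒∣m+n; ∣m⇒∣-m; ∣n⇒∣m*n; *-monoʳ-∣)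
open import Data.Integer.Tactic.RingSolver using (solve-∀)
open import Data.Fin.Base using (Fin)
open import Data.Fin.Permutation using (Permutation; permutation)
open import Algebra.Bundles using (Group; AbelianGroup)
open import Algebra.Morphism.Structures using (module GroupMorphisms)
import Algebra.Properties.Group as GroupProperties
import Algebra.Morphism.Construct.Composition as Composition
import Algebra.Properties.CommutativeMonoid.Sum as Sum
import Algebra.Definitions.RawMonoid as RawMonoidDefinitions
open import Relation.Unary using (Pred)
open import Relation.Nullary using (¬_)
open import Relation.Binary.Bundles using (Setoid)
open import Relation.Binary.PropositionalEquality as ≡ using (_≡_; _≢_)

-- A record, not a synonym, so that x, y and n can be inferred; its field is literally the
-- equality Group._≈_ (ℤ/ n) x y of Defs.
infix 4 _≡_mod_
record _≡_mod_ (x y : ℤ) (n : ℕ) : Set where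
  constructor ≡-mod
  field ∣-diff : + n ∣ x - y
open _≡_mod_

module Mod (n : ℕ) where

  reflexive : ∀ {x y} → x ≡ y → x ≡ y mod n
  reflexive {x} ≡.refl = ≡-mod (divides 0ℤ (≡.trans (ℤP.+-inverseʳ x) (≡.sym (ℤP.*-zeroˡ (+ n)))))

  refl : ∀ {x} → x ≡ x mod n
  refl = reflexive ≡.refl

  sym : ∀ {x y} → x ≡ y mod n → y ≡ x mod n
  sym {x} {y} (≡-mod n∣x-y) = ≡-mod (≡.subst (+ n ∣_) (negate x y) (∣m⇒∣-m n∣x-y))
    where negate : ∀ x y → - (x - y) ≡ y - x
          negate = solve-∀

  trans : ∀ {x y z} → x ≡ y mod n → y ≡ z mod n → x ≡ z mod n
  trans {x} {y} {z} (≡-mod n∣x-y) (≡-mod n∣y-z) =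
    ≡-mod (≡.subst (+ n ∣_) (telescope x y z) (∣m∣n⇒∣m+n n∣x-y n∣y-z))
    where telescope : ∀ x y z → (x - y) + (y - z) ≡ x - z
          telescope = solve-∀

  setoid : Setoid 0ℓ 0ℓ
  setoid = record
    { Carrier = ℤ
    ; _≈_ = λ x y → x ≡ y mod n
    ; isEquivalence = record { refl = refl ; sym = sym ; trans = trans }
    }

  +-cong : ∀ {x y u v} → x ≡ y mod n → u ≡ v mod n → x + u ≡ y + v mod n
  +-cong {x} {y} {u} {v} (≡-mod n∣x-y) (≡-mod n∣u-v) =
    ≡-mod (≡.subst (+ n ∣_) (regroup x y u v) (∣m∣n⇒∣m+n n∣x-y n∣u-v))
    where regroup : ∀ x y u v → (x - y) + (u - v) ≡ (x + u) - (y + v)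
          regroup = solve-∀

  +-congˡ : ∀ x {u v} → u ≡ v mod n → x + u ≡ x + v mod n
  +-congˡ x = +-cong (refl {x})

  +-congʳ : ∀ u {x y} → x ≡ y mod n → x + u ≡ y + u mod n
  +-congʳ u x≡y = +-cong x≡y (refl {u})

  *-congˡ : ∀ k {x y} → x ≡ y mod n → k * x ≡ k * y mod n
  *-congˡ k {x} {y} (≡-mod n∣x-y) = ≡-mod (≡.subst (+ n ∣_) (distrib k x y) (∣n⇒∣m*n k n∣x-y))
    where distrib : ∀ k x y → k * (x - y) ≡ k * x - k * y
          distrib = solve-∀

  +-cancelʳ : ∀ {x y} z → x + z ≡ y + z mod n → x ≡ y mod n
  +-cancelʳ {x} {y} z x+z≡y+z = begin
    x             ≡⟨ cancel x z ⟨
    x + z + - z   ≈⟨ +-congʳ (- z) x+z≡y+z ⟩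
    y + z + - z   ≡⟨ cancel y z ⟩
    y             ∎
    where open import Relation.Binary.Reasoning.Setoid setoid
          cancel : ∀ x z → x + z + - z ≡ x
          cancel = solve-∀

  ∣⇒≡0 : ∀ {x} → + n ∣ x → x ≡ 0ℤ mod n
  ∣⇒≡0 {x} n∣x = ≡-mod (≡.subst (+ n ∣_) (≡.sym (ℤP.+-identityʳ x)) n∣x)

  ≡0⇒∣ : ∀ {x} → x ≡ 0ℤ mod n → + n ∣ x
  ≡0⇒∣ {x} (≡-mod n∣x-0) = ≡.subst (+ n ∣_) (ℤP.+-identityʳ x) n∣x-0

≡-mod-∣ : ∀ {d n x y} → d ∣ℕ n → x ≡ y mod n → x ≡ y mod d
≡-mod-∣ d∣n (≡-mod n∣x-y) = ≡-mod (∣-trans (∣ᵤ⇒∣ d∣n) n∣x-y)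

additive⇒linear : ∀ {n} (f : ℤ → ℤ) → (∀ x y → f (x + y) ≡ f x + f y mod n) →
                  ∀ x → f x ≡ x * f 1ℤ mod n
additive⇒linear {n} f f-additive = linear
  where
  open Mod n
  open import Relation.Binary.Reasoning.Setoid setoid

  f0≡0 : f 0ℤ ≡ 0ℤ mod n
  f0≡0 = +-cancelʳ (f 0ℤ) (begin
    f 0ℤ + f 0ℤ   ≈⟨ f-additive 0ℤ 0ℤ ⟨
    f 0ℤ          ≡⟨ ℤP.+-identityˡ (f 0ℤ) ⟨
    0ℤ + f 0ℤ     ∎)

  linear-+ : ∀ k → f (+ k) ≡ + k * f 1ℤ mod n
  linear-+ zero = trans f0≡0 (reflexive (≡.sym (ℤP.*-zeroˡ (f 1ℤ))))
  linear-+ (suc k) = begin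
    f (1ℤ + + k)          ≈⟨ f-additive 1ℤ (+ k) ⟩
    f 1ℤ + f (+ k)        ≈⟨ +-congˡ (f 1ℤ) (linear-+ k) ⟩
    f 1ℤ + + k * f 1ℤ     ≡⟨ distrib (+ k) (f 1ℤ) ⟩
    (1ℤ + + k) * f 1ℤ     ∎
    where distrib : ∀ k y → y + k * y ≡ (1ℤ + k) * y
          distrib = solve-∀

  linear : ∀ x → f x ≡ x * f 1ℤ mod n
  linear (+ k) = linear-+ k
  linear -[1+ k ] = +-cancelʳ (+ suc k * f 1ℤ) (begin
    f -[1+ k ] + + suc k * f 1ℤ      ≈⟨ +-congˡ (f -[1+ k ]) (linear-+ (suc k)) ⟨
    f -[1+ k ] + f (+ suc k)         ≈⟨ f-additive -[1+ k ] (+ suc k) ⟨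
    f (-[1+ k ] + + suc k)           ≡⟨ ≡.cong f (ℤP.+-inverseˡ (+ suc k)) ⟩
    f 0ℤ                             ≈⟨ f0≡0 ⟩
    0ℤ                               ≡⟨ cancel (+ suc k) (f 1ℤ) ⟨
    -[1+ k ] * f 1ℤ + + suc k * f 1ℤ ∎)
    where cancel : ∀ x y → (- x) * y + x * y ≡ 0ℤ
          cancel = solve-∀

prime∤⇒coprime : ∀ {p x} → Prime p → ¬ p ∣ℕ x → Coprime p x
prime∤⇒coprime p-prime p∤x (d∣p , d∣x) with prime⇒irreducible p-prime d∣p
... | inj₁ d≡1 = d≡1
... | inj₂ ≡.refl = ⊥-elim (p∤x d∣x)

coprime-*ˡ : ∀ {m n x} → Coprime m x → Coprime n x → Coprime (m ℕ.* n) x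
coprime-*ˡ {m} {n} {x} m⊥x n⊥x {d} (d∣mn , d∣x) = n⊥x (coprime-divisor d⊥m d∣mn , d∣x)
  where
  d⊥m : Coprime d m
  d⊥m (e∣d , e∣m) = m⊥x (e∣m , ℕD.∣-trans e∣d d∣x)

coprime-^ˡ : ∀ {m x} k → Coprime m x → Coprime (m ^ k) x
coprime-^ˡ {x = x} zero    _   = Coprimality.1-coprimeTo x
coprime-^ˡ         (suc k) m⊥x = coprime-*ˡ m⊥x (coprime-^ˡ k m⊥x)

coprime⇒*∣ : ∀ {m n x} → Coprime m n → m ∣ℕ x → n ∣ℕ x → m ℕ.* n ∣ℕ x
coprime⇒*∣ {m} {n} m⊥n (ℕD.divides k ≡.refl) n∣km
  with coprime-divisor (Coprimality.sym m⊥n) (≡.subst (n ∣ℕ_) (ℕP.*-comm k m) n∣km)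
... | ℕD.divides j ≡.refl = ℕD.divides j (≡.trans (ℕP.*-assoc j n m) (≡.cong (j ℕ.*_) (ℕP.*-comm n m)))

coprime-divisorᶻ : ∀ {m n} z → Coprime m n → + m ∣ + n * z → + m ∣ z
coprime-divisorᶻ {m} {n} z m⊥n m∣nz =
  ∣ᵤ⇒∣ (coprime-divisor m⊥n (≡.subst (m ∣ℕ_) (ℤP.abs-* (+ n) z) (∣⇒∣ᵤ m∣nz)))

coprime⇒*∣ᶻ : ∀ {m n} z → Coprime m n → + m ∣ z → + n ∣ z → + (m ℕ.* n) ∣ z
coprime⇒*∣ᶻ z m⊥n m∣z n∣z = ∣ᵤ⇒∣ (coprime⇒*∣ m⊥n (∣⇒∣ᵤ m∣z) (∣⇒∣ᵤ n∣z))

mod-inverseᴺ : ∀ {n c} → Coprime c n → ∃ λ u → u * + c ≡ 1ℤ mod n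
mod-inverseᴺ {n} {c} c⊥n with coprime-Bézout c⊥n
... | Bézout.+- x y 1+yn≡xc = + x , ≡-mod (divides (+ y) (begin
  + x * + c - 1ℤ        ≡⟨ ≡.cong (_- 1ℤ) (ℤP.pos-* x c) ⟨
  + (x ℕ.* c) - 1ℤ      ≡⟨ ≡.cong (λ w → + w - 1ℤ) 1+yn≡xc ⟨
  1ℤ + + (y ℕ.* n) - 1ℤ ≡⟨ cancel (+ (y ℕ.* n)) ⟩
  + (y ℕ.* n)           ≡⟨ ℤP.pos-* y n ⟩
  + y * + n             ∎))
  where open ≡.≡-Reasoning
        cancel : ∀ z → 1ℤ + z - 1ℤ ≡ z
        cancel = solve-∀
... | Bézout.-+ x y 1+xc≡yn = - + x , ≡-mod (divides (- + y) (begin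
  - + x * + c - 1ℤ         ≡⟨ negate (+ x) (+ c) ⟩
  - (1ℤ + + x * + c)       ≡⟨ ≡.cong (λ w → - (1ℤ + w)) (ℤP.pos-* x c) ⟨
  - (1ℤ + + (x ℕ.* c))     ≡⟨ ≡.cong (λ w → - + w) 1+xc≡yn ⟩
  - + (y ℕ.* n)            ≡⟨ ≡.cong -_ (ℤP.pos-* y n) ⟩
  - (+ y * + n)            ≡⟨ ℤP.neg-distribˡ-* (+ y) (+ n) ⟩
  - + y * + n              ∎))
  where open ≡.≡-Reasoning
        negate : ∀ a b → - a * b - 1ℤ ≡ - (1ℤ + a * b)
        negate = solve-∀

mod-inverse : ∀ {n} c → Coprime n ∣ c ∣ → ∃ λ u → u * c ≡ 1ℤ mod n
mod-inverse {n} c n⊥c with mod-inverseᴺ (Coprimality.sym n⊥c) | ℤP.+∣i∣≡i⊎+∣i∣≡-i c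
... | u , u∣c∣≡1 | inj₁ ∣c∣≡c  = u , ≡.subst (λ w → u * w ≡ 1ℤ mod n) ∣c∣≡c u∣c∣≡1
... | u , u∣c∣≡1 | inj₂ ∣c∣≡-c =
  - u , Mod.trans n (Mod.reflexive n (swap u c)) (≡.subst (λ w → u * w ≡ 1ℤ mod n) ∣c∣≡-c u∣c∣≡1)
  where swap : ∀ u c → - u * c ≡ u * - c
        swap = solve-∀

open GroupMorphisms using (IsGroupHomomorphism; IsGroupIsomorphism)

private
  variable
    a₁ a₂ a₃ ℓ ℓ₁ ℓ₂ ℓ₃ : Level

module _ {G : Group a₁ ℓ₁} {A : Group a₂ ℓ₂} {f : Group.Carrier G → Group.Carrier A} where
  private
    module G = Group G
    module A = Group A
  open GroupProperties A using (identityˡ-unique; inverseˡ-unique)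
  open import Relation.Binary.Reasoning.Setoid A.setoid

  ∙-homo⇒isGroupHomomorphism : (∀ {x y} → x G.≈ y → f x A.≈ f y) →
                               (∀ x y → f (x G.∙ y) A.≈ f x A.∙ f y) →
                               IsGroupHomomorphism G.rawGroup A.rawGroup f
  ∙-homo⇒isGroupHomomorphism f-cong f-homo = record
    { isMonoidHomomorphism = record
      { isMagmaHomomorphism = record { isRelHomomorphism = record { cong = f-cong } ; homo = f-homo }
      ; ε-homo = f-ε
      }
    ; ⁻¹-homo = f-⁻¹
    }
    where
    f-ε : f G.ε A.≈ A.ε
    f-ε = identityˡ-unique (f G.ε) (f G.ε) (begin
      f G.ε A.∙ f G.ε   ≈⟨ f-homo G.ε G.ε ⟨
      f (G.ε G.∙ G.ε)   ≈⟨ f-cong (G.identityˡ G.ε) ⟩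
      f G.ε             ∎)

    f-⁻¹ : ∀ x → f (x G.⁻¹) A.≈ f x A.⁻¹
    f-⁻¹ x = inverseˡ-unique (f (x G.⁻¹)) (f x) (begin
      f (x G.⁻¹) A.∙ f x   ≈⟨ f-homo (x G.⁻¹) x ⟨
      f (x G.⁻¹ G.∙ x)     ≈⟨ f-cong (G.inverseˡ x) ⟩
      f G.ε                ≈⟨ f-ε ⟩
      A.ε                  ∎)

module _ (G : Group a₁ ℓ₁) where
  open Group G

  subgroup-inclusion : {S : Pred Carrier ℓ} (S-sub : IsSubgroup G S) →
                       IsGroupHomomorphism (Group.rawGroup (subgroup G S-sub)) rawGroup proj₁
  subgroup-inclusion S-sub = ∙-homo⇒isGroupHomomorphism {G = subgroup G S-sub} {G} id (λ _ _ → refl)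

  quotient-projection : {N : Pred Carrier ℓ} (N-normal : IsNormalSubgroup G N) →
                        IsGroupHomomorphism rawGroup (Group.rawGroup (quotient G N-normal)) id
  quotient-projection N-normal = ∙-homo⇒isGroupHomomorphism {G = G} {quotient G N-normal}
    (λ x≈y → resp (sym (x≈y⇒x∙y⁻¹≈ε x≈y)) ε∈) (λ x y → Group.refl (quotient G N-normal) {x ∙ y})
    where open IsNormalSubgroup N-normal
          open GroupProperties G using (x≈y⇒x∙y⁻¹≈ε)

module ≅-Inverse {G : Group a₁ ℓ₁} {A : Group a₂ ℓ₂} (G≅A : G ≅ A) where
  private
    module G = Group G
    module A = Group A
    module α = IsGroupIsomorphism (proj₂ G≅A)

    α : G.Carrier → A.Carrier
    α = proj₁ G≅A

  from : A.Carrier → G.Carrier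
  from y = proj₁ (α.surjective y)

  to-from : ∀ y → α (from y) A.≈ y
  to-from y = proj₂ (α.surjective y) G.refl

  from-to : ∀ x → from (α x) G.≈ x
  from-to x = α.injective (to-from (α x))

  from-cong : ∀ {y y′} → y A.≈ y′ → from y G.≈ from y′
  from-cong y≈y′ = α.injective (A.trans (to-from _) (A.trans y≈y′ (A.sym (to-from _))))

  from-homo : ∀ y y′ → from (y A.∙ y′) G.≈ from y G.∙ from y′
  from-homo y y′ = α.injective (A.trans (to-from _) (A.sym (A.trans (α.∙-homo _ _) (A.∙-cong (to-from y) (to-from y′)))))

HasOrder-≅ : {G : Group a₁ ℓ₁} {A : Group a₂ ℓ₂} {n : ℕ} → G ≅ A → HasOrder A n → HasOrder G n
HasOrder-≅ {G = G} {A} G≅A (e , e-injective , e-surjective) =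
    from ∘ e
  , (λ i j ei≈ej → e-injective i j (A.trans (A.sym (to-from (e i))) (A.trans (α.⟦⟧-cong ei≈ej) (to-from (e j)))))
  , λ x → let (i , ei≈αx) = e-surjective (proj₁ G≅A x) in i , G.trans (from-cong ei≈αx) (from-to x)
  where
  module G = Group G
  module A = Group A
  module α = IsGroupIsomorphism (proj₂ G≅A)
  open ≅-Inverse {G = G} {A} G≅A

module Translation (G : Group a₁ ℓ₁) {n : ℕ} (G-order : HasOrder G n) where
  open Group G
  open import Relation.Binary.Reasoning.Setoid setoid

  private
    e = proj₁ G-order
    e-injective = proj₁ (proj₂ G-order)
    e-surjective = proj₂ (proj₂ G-order)

  translate : Carrier → Fin n → Fin n
  translate x i = proj₁ (e-surjective (x ∙ e i))

  e-translate : ∀ x i → e (translate x i) ≈ x ∙ e i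
  e-translate x i = proj₂ (e-surjective (x ∙ e i))

  translate-cancel : ∀ x y → x ∙ y ≈ ε → ∀ i → translate x (translate y i) ≡ i
  translate-cancel x y xy≈ε i = e-injective _ i (begin
    e (translate x (translate y i))   ≈⟨ e-translate x (translate y i) ⟩
    x ∙ e (translate y i)             ≈⟨ ∙-congˡ (e-translate y i) ⟩
    x ∙ (y ∙ e i)                     ≈⟨ assoc x y (e i) ⟨
    (x ∙ y) ∙ e i                     ≈⟨ ∙-congʳ xy≈ε ⟩
    ε ∙ e i                           ≈⟨ identityˡ (e i) ⟩
    e i                               ∎)

  translation : Carrier → Permutation n n
  translation x = permutation (translate x) (translate (x ⁻¹))
                    (translate-cancel x (x ⁻¹) (inverseʳ x))
                    (translate-cancel (x ⁻¹) x (inverseˡ x))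

module _ {G : Group a₁ ℓ₁} {A : AbelianGroup a₂ ℓ₂} {f : Group.Carrier G → AbelianGroup.Carrier A}
         (f-hom : IsGroupHomomorphism (Group.rawGroup G) (AbelianGroup.rawGroup A) f) where
  private
    module G = Group G
    module A = AbelianGroup A
  open IsGroupHomomorphism f-hom
  open RawMonoidDefinitions A.rawMonoid using () renaming (_×_ to _×ᴬ_)
  open Sum A.commutativeMonoid using (sum; sum-permute; ∑-distrib-+; sum-replicate; sum-cong-≋)
  open GroupProperties A.group using (identityˡ-unique)
  open import Relation.Binary.Reasoning.Setoid A.setoid

  -- Σᵢ f (e i) is unchanged when the enumeration e is translated by x, which adds n × f x to it.
  order-×-homo≈ε : ∀ {n} → HasOrder G n → ∀ x → n ×ᴬ f x A.≈ A.ε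
  order-×-homo≈ε {n} G-order x =
    identityˡ-unique (n ×ᴬ f x) (sum (f ∘ e)) (begin
      n ×ᴬ f x A.∙ sum (f ∘ e)             ≈⟨ A.∙-congʳ (sum-replicate n) ⟨
      sum {n} (λ _ → f x) A.∙ sum (f ∘ e)  ≈⟨ ∑-distrib-+ (λ _ → f x) (f ∘ e) ⟨
      sum (λ i → f x A.∙ f (e i))          ≈⟨ sum-cong-≋ (λ i → A.sym (homo x (e i))) ⟩
      sum (λ i → f (x G.∙ e i))            ≈⟨ sum-cong-≋ (λ i → ⟦⟧-cong (e-translate x i)) ⟨
      sum (f ∘ e ∘ translate x)            ≈⟨ sum-permute (f ∘ e) (translation x) ⟨
      sum (f ∘ e)                          ∎)
    where
    e = proj₁ G-order
    open Translation G G-order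

pair-isGroupHomomorphism : {G : Group a₁ ℓ₁} {A : Group a₂ ℓ₂} {C : Group a₃ ℓ₃}
                           {f : Group.Carrier G → Group.Carrier A} {g : Group.Carrier G → Group.Carrier C} →
                           IsGroupHomomorphism (Group.rawGroup G) (Group.rawGroup A) f →
                           IsGroupHomomorphism (Group.rawGroup G) (Group.rawGroup C) g →
                           IsGroupHomomorphism (Group.rawGroup G) (Group.rawGroup (A ×ᴳ C)) < f , g >
pair-isGroupHomomorphism {G = G} {A} {C} f-hom g-hom =
  ∙-homo⇒isGroupHomomorphism {G = G} {A ×ᴳ C}
    (λ x≈y → f.⟦⟧-cong x≈y , g.⟦⟧-cong x≈y) (λ x y → f.homo x y , g.homo x y)
  where module f = IsGroupHomomorphism f-hom
        module g = IsGroupHomomorphism g-hom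

module InternalProduct
  (G : Group a₁ ℓ₁) {K H : Pred (Group.Carrier G) ℓ}
  (K-normal : IsNormalSubgroup G K) (H-sub : IsSubgroup G H)
  (K∩H≈ε : ∀ x → K x → H x → Group._≈_ G x (Group.ε G))
  (G≈KH : ∀ g → ∃ λ k → ∃ λ h → K k × H h × Group._≈_ G g (Group._∙_ G k h))
  where
  open Group G
  open GroupProperties G using (x∙y⁻¹≈ε⇒x≈y; ⁻¹-anti-homo-∙; \\-leftDividesˡ; \\-leftDividesʳ; //-rightDividesʳ; ∙-cancelˡ)
  private
    module K = IsNormalSubgroup K-normal
    module H = IsSubgroup H-sub

  decomposition-unique : ∀ {k h k′ h′} → K k → H h → K k′ → H h′ →
                         k ∙ h ≈ k′ ∙ h′ → k ≈ k′ × h ≈ h′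
  decomposition-unique {k} {h} {k′} {h′} k∈K h∈H k′∈K h′∈H kh≈k′h′ = k≈k′ , h≈h′
    where
    open import Relation.Binary.Reasoning.Setoid setoid

    k′⁻¹k≈h′h⁻¹ : k′ ⁻¹ ∙ k ≈ h′ ∙ h ⁻¹
    k′⁻¹k≈h′h⁻¹ = begin
      k′ ⁻¹ ∙ k                   ≈⟨ ∙-congˡ (//-rightDividesʳ h k) ⟨
      k′ ⁻¹ ∙ ((k ∙ h) ∙ h ⁻¹)    ≈⟨ ∙-congˡ (∙-congʳ kh≈k′h′) ⟩
      k′ ⁻¹ ∙ ((k′ ∙ h′) ∙ h ⁻¹)  ≈⟨ ∙-congˡ (assoc k′ h′ (h ⁻¹)) ⟩
      k′ ⁻¹ ∙ (k′ ∙ (h′ ∙ h ⁻¹))  ≈⟨ \\-leftDividesʳ k′ (h′ ∙ h ⁻¹) ⟩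
      h′ ∙ h ⁻¹                   ∎

    k′⁻¹k≈ε : k′ ⁻¹ ∙ k ≈ ε
    k′⁻¹k≈ε = K∩H≈ε _ (K.∙∈ (K.⁻¹∈ k′∈K) k∈K) (H.resp (sym k′⁻¹k≈h′h⁻¹) (H.∙∈ h′∈H (H.⁻¹∈ h∈H)))

    k≈k′ : k ≈ k′
    k≈k′ = begin
      k                  ≈⟨ \\-leftDividesˡ k′ k ⟨
      k′ ∙ (k′ ⁻¹ ∙ k)   ≈⟨ ∙-congˡ k′⁻¹k≈ε ⟩
      k′ ∙ ε             ≈⟨ identityʳ k′ ⟩
      k′                 ∎

    h≈h′ : h ≈ h′
    h≈h′ = ∙-cancelˡ k′ h h′ (trans (∙-congʳ (sym k≈k′)) kh≈k′h′)

  complements-commute : {N : Pred Carrier ℓ₂} (N-normal : IsNormalSubgroup G N) →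
                        (∀ x y → Group._≈_ (quotient G N-normal) (x ∙ y) (y ∙ x)) →
                        (∀ {x} → N x → H x) →
                        ∀ {k h} → K k → H h → k ∙ h ≈ h ∙ k
  complements-commute _ G/N-comm N⊆H {k} {h} k∈K h∈H =
    x∙y⁻¹≈ε⇒x≈y (k ∙ h) (h ∙ k) (K∩H≈ε _ commutator∈K (N⊆H (G/N-comm k h)))
    where
    open import Relation.Binary.Reasoning.Setoid setoid

    commutator∈K : K ((k ∙ h) ∙ (h ∙ k) ⁻¹)
    commutator∈K = K.resp (sym (begin
      (k ∙ h) ∙ (h ∙ k) ⁻¹      ≈⟨ ∙-congˡ (⁻¹-anti-homo-∙ h k) ⟩
      (k ∙ h) ∙ (k ⁻¹ ∙ h ⁻¹)   ≈⟨ assoc k h (k ⁻¹ ∙ h ⁻¹) ⟩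
      k ∙ (h ∙ (k ⁻¹ ∙ h ⁻¹))   ≈⟨ ∙-congˡ (assoc h (k ⁻¹) (h ⁻¹)) ⟨
      k ∙ ((h ∙ k ⁻¹) ∙ h ⁻¹)   ∎))
      (K.∙∈ k∈K (K.conj∈ h (K.⁻¹∈ k∈K)))

  k-part h-part : Carrier → Carrier
  k-part g = proj₁ (G≈KH g)
  h-part g = proj₁ (proj₂ (G≈KH g))

  k-part∈K : ∀ g → K (k-part g)
  k-part∈K g = proj₁ (proj₂ (proj₂ (G≈KH g)))

  h-part∈H : ∀ g → H (h-part g)
  h-part∈H g = proj₁ (proj₂ (proj₂ (proj₂ (G≈KH g))))

  g≈k-part∙h-part : ∀ g → g ≈ k-part g ∙ h-part g
  g≈k-part∙h-part g = proj₂ (proj₂ (proj₂ (proj₂ (G≈KH g))))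

  h-part-unique : ∀ {g k h} → K k → H h → g ≈ k ∙ h → h-part g ≈ h
  h-part-unique {g} k∈K h∈H g≈kh =
    proj₂ (decomposition-unique (k-part∈K g) (h-part∈H g) k∈K h∈H (trans (sym (g≈k-part∙h-part g)) g≈kh))

  module _ (commute : ∀ {k h} → K k → H h → k ∙ h ≈ h ∙ k) where

    interchange : ∀ {k h k′ h′} → K k′ → H h → (k ∙ h) ∙ (k′ ∙ h′) ≈ (k ∙ k′) ∙ (h ∙ h′)
    interchange {k} {h} {k′} {h′} k′∈K h∈H = begin
      (k ∙ h) ∙ (k′ ∙ h′)   ≈⟨ assoc k h (k′ ∙ h′) ⟩
      k ∙ (h ∙ (k′ ∙ h′))   ≈⟨ ∙-congˡ (assoc h k′ h′) ⟨
      k ∙ ((h ∙ k′) ∙ h′)   ≈⟨ ∙-congˡ (∙-congʳ (commute k′∈K h∈H)) ⟨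
      k ∙ ((k′ ∙ h) ∙ h′)   ≈⟨ ∙-congˡ (assoc k′ h h′) ⟩
      k ∙ (k′ ∙ (h ∙ h′))   ≈⟨ assoc k k′ (h ∙ h′) ⟨
      (k ∙ k′) ∙ (h ∙ h′)   ∎
      where open import Relation.Binary.Reasoning.Setoid setoid

    h-part-isGroupHomomorphism :
      IsGroupHomomorphism rawGroup (Group.rawGroup (subgroup G H-sub)) (λ g → h-part g , h-part∈H g)
    h-part-isGroupHomomorphism = ∙-homo⇒isGroupHomomorphism {G = G} {subgroup G H-sub}
      (λ {g} g≈g′ → sym (h-part-unique (k-part∈K g) (h-part∈H g) (trans (sym g≈g′) (g≈k-part∙h-part g))))
      (λ g g′ → h-part-unique (K.∙∈ (k-part∈K g) (k-part∈K g′)) (H.∙∈ (h-part∈H g) (h-part∈H g′))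
                  (trans (∙-cong (g≈k-part∙h-part g) (g≈k-part∙h-part g′)) (interchange (k-part∈K g′) (h-part∈H g))))

    module _ {A : Group a₂ ℓ₂} {C : Group a₃ ℓ₃} {φ : Carrier → Group.Carrier A}
             (φ-hom : IsGroupHomomorphism rawGroup (Group.rawGroup A) φ)
             (φ-surjective : Surjective _≈_ (Group._≈_ A) φ)
             (H⊆kerφ : ∀ {h} → H h → Group._≈_ A (φ h) (Group.ε A))
             (K∩kerφ≈ε : ∀ {k} → K k → Group._≈_ A (φ k) (Group.ε A) → k ≈ ε)
             (H≅C : subgroup G H-sub ≅ C)
             where
      private
        module A = Group A
        module C = Group C
        module φ = IsGroupHomomorphism φ-hom
        module θ = IsGroupIsomorphism (proj₂ H≅C)
        open GroupProperties A using () renaming (x≈y⇒x∙y⁻¹≈ε to x≈y⇒x∙y⁻¹≈εᴬ)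

        θ : Σ Carrier H → C.Carrier
        θ = proj₁ H≅C

        Φ : Carrier → A.Carrier × C.Carrier
        Φ = < φ , (λ g → θ (h-part g , h-part∈H g)) >

        φ-∙H : ∀ x {h} → H h → φ (x ∙ h) A.≈ φ x
        φ-∙H x {h} h∈H = begin
          φ (x ∙ h)     ≈⟨ φ.homo x h ⟩
          φ x A.∙ φ h   ≈⟨ A.∙-congˡ (H⊆kerφ h∈H) ⟩
          φ x A.∙ A.ε   ≈⟨ A.identityʳ (φ x) ⟩
          φ x           ∎
          where open import Relation.Binary.Reasoning.Setoid A.setoid

        φ-k-part : ∀ g → φ (k-part g) A.≈ φ g
        φ-k-part g = A.sym (A.trans (φ.⟦⟧-cong (g≈k-part∙h-part g)) (φ-∙H (k-part g) (h-part∈H g)))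

        k-part-injective : ∀ {g g′} → φ g A.≈ φ g′ → k-part g ≈ k-part g′
        k-part-injective {g} {g′} φg≈φg′ = x∙y⁻¹≈ε⇒x≈y _ _
          (K∩kerφ≈ε (K.∙∈ (k-part∈K g) (K.⁻¹∈ (k-part∈K g′))) (begin
            φ (k-part g ∙ k-part g′ ⁻¹)              ≈⟨ φ.homo (k-part g) (k-part g′ ⁻¹) ⟩
            φ (k-part g) A.∙ φ (k-part g′ ⁻¹)        ≈⟨ A.∙-congˡ (φ.⁻¹-homo (k-part g′)) ⟩
            φ (k-part g) A.∙ φ (k-part g′) A.⁻¹      ≈⟨ A.∙-cong (φ-k-part g) (A.⁻¹-cong (φ-k-part g′)) ⟩
            φ g A.∙ φ g′ A.⁻¹                        ≈⟨ x≈y⇒x∙y⁻¹≈εᴬ φg≈φg′ ⟩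
            A.ε                                      ∎))
          where open import Relation.Binary.Reasoning.Setoid A.setoid

        Φ-injective : ∀ {g g′} → Group._≈_ (A ×ᴳ C) (Φ g) (Φ g′) → g ≈ g′
        Φ-injective {g} {g′} (φg≈φg′ , θh≈θh′) = begin
          g                       ≈⟨ g≈k-part∙h-part g ⟩
          k-part g ∙ h-part g     ≈⟨ ∙-cong (k-part-injective φg≈φg′) (θ.injective θh≈θh′) ⟩
          k-part g′ ∙ h-part g′   ≈⟨ g≈k-part∙h-part g′ ⟨
          g′                      ∎
          where open import Relation.Binary.Reasoning.Setoid setoid

        Φ-surjective : Surjective _≈_ (Group._≈_ (A ×ᴳ C)) Φ
        Φ-surjective (a , c) = k-part g ∙ proj₁ h , λ z≈x →
            A.trans (φ.⟦⟧-cong z≈x) (A.trans (φ-∙H (k-part g) (proj₂ h)) (A.trans (φ-k-part g) φg≈a))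
          , C.trans (θ.⟦⟧-cong (h-part-unique (k-part∈K g) (proj₂ h) z≈x)) θh≈c
          where
          g : Carrier
          g = proj₁ (φ-surjective a)

          φg≈a : φ g A.≈ a
          φg≈a = proj₂ (φ-surjective a) refl

          h : Σ Carrier H
          h = proj₁ (θ.surjective c)

          θh≈c : θ h C.≈ c
          θh≈c = proj₂ (θ.surjective c) {h} refl

      ≅-×ᴳ : G ≅ (A ×ᴳ C)
      ≅-×ᴳ = Φ , record
        { isGroupMonomorphism = record
          { isGroupHomomorphism = pair-isGroupHomomorphism {G = G} {A} {C} φ-hom
              (Composition.isGroupHomomorphism {G₂ = Group.rawGroup (subgroup G H-sub)} C.trans
                 h-part-isGroupHomomorphism θ.isGroupHomomorphism)
          ; injective = Φ-injective
          }
        ; surjective = Φ-surjective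
        }

ℤ/-abelianGroup : ℕ → AbelianGroup 0ℓ 0ℓ
ℤ/-abelianGroup n = record
  { isAbelianGroup = record
    { isGroup = Group.isGroup (ℤ/ n)
    ; comm = λ x y → Group.reflexive (ℤ/ n) (ℤP.+-comm x y)
    }
  }

module _ (n : ℕ) where
  open RawMonoidDefinitions (AbelianGroup.rawMonoid (ℤ/-abelianGroup n)) using () renaming (_×_ to _×ᴺ_)

  ×ᴺ≡* : ∀ k x → k ×ᴺ x ≡ + k * x
  ×ᴺ≡* zero    x = ≡.sym (ℤP.*-zeroˡ x)
  ×ᴺ≡* (suc k) x = ≡.trans (≡.cong (λ y → x + y) (×ᴺ≡* k x)) (distrib (+ k) x)
    where distrib : ∀ k x → x + k * x ≡ (1ℤ + k) * x
          distrib = solve-∀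

ℤ/-reduction : ∀ {d n} → d ∣ℕ n → IsGroupHomomorphism (Group.rawGroup (ℤ/ n)) (Group.rawGroup (ℤ/ d)) id
ℤ/-reduction {d} {n} d∣n = ∙-homo⇒isGroupHomomorphism {G = ℤ/ n} {ℤ/ d}
  (∣-trans (∣ᵤ⇒∣ d∣n)) (λ x y → Group.refl (ℤ/ d) {x + y})

module Proof
  (p l₁ l₂ s m : ℕ) (p-prime : Prime p) (l₂-prime : Prime l₂) (p≢l₂ : p ≢ l₂)
  (l₁>0 : 0 < l₁) (p∤l₁ : ¬ p ∣ℕ l₁) (d : l₂ ^ s ∣ℕ l₁)
  (G P : Group 0ℓ 0ℓ) (P-pgroup : IsPGroup p P)
  {K H : Pred (Group.Carrier G) 0ℓ} (K-normal : IsNormalSubgroup G K) (H-sub : IsSubgroup G H)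
  (K≅P : subgroup G (IsNormalSubgroup.isSubgroup K-normal) ≅ P)
  (H≅ℤ/l₁l₂ : subgroup G H-sub ≅ ℤ/ (l₁ ℕ.* l₂))
  (K∩H≈ε : ∀ x → K x → H x → Group._≈_ G x (Group.ε G))
  {N : Pred (Group.Carrier G) 0ℓ} (N-normal : IsNormalSubgroup G N)
  (N≅ℤ/l₂ˢ⁺¹ : subgroup G (IsNormalSubgroup.isSubgroup N-normal) ≅ ℤ/ (l₂ ^ suc s))
  (G/N≅ℤ/qpᵐ : quotient G N-normal ≅ ℤ/ (ℕD._∣_.quotient d ℕ.* p ^ m))
  where

  open Group G
  private
    module K = IsNormalSubgroup K-normal
    module H = IsSubgroup H-sub
    module N = IsNormalSubgroup N-normal

  q M : ℕ
  q = ℕD._∣_.quotient d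
  M = q ℕ.* p ^ m

  pᵐ∣M : p ^ m ∣ℕ M
  pᵐ∣M = ℕD.divides q ≡.refl

  p⊥l₁l₂ : Coprime p (l₁ ℕ.* l₂)
  p⊥l₁l₂ = Coprimality.sym (coprime-*ˡ (Coprimality.sym (prime∤⇒coprime p-prime p∤l₁))
                                       (Coprimality.sym (prime∤⇒coprime p-prime p∤l₂)))
    where
    p∤l₂ : ¬ p ∣ℕ l₂
    p∤l₂ p∣l₂ with prime⇒irreducible l₂-prime p∣l₂
    ... | inj₁ ≡.refl = ¬prime[1] p-prime
    ... | inj₂ p≡l₂  = p≢l₂ p≡l₂

  q⊥pᵏ : ∀ k → Coprime q (p ^ k)
  q⊥pᵏ k = Coprimality.sym (coprime-^ˡ k (prime∤⇒coprime p-prime p∤q))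
    where
    p∤q : ¬ p ∣ℕ q
    p∤q p∣q = p∤l₁ (ℕD.∣-trans p∣q (ℕD.divides (l₂ ^ s) (≡.trans (ℕD._∣_.equality d) (ℕP.*-comm q (l₂ ^ s)))))

  ψ : Carrier → ℤ
  ψ = proj₁ G/N≅ℤ/qpᵐ

  ψ-isGroupHomomorphism : IsGroupHomomorphism rawGroup (Group.rawGroup (ℤ/ M)) ψ
  ψ-isGroupHomomorphism = Composition.isGroupHomomorphism
    {G₂ = Group.rawGroup (quotient G N-normal)} {G₃ = Group.rawGroup (ℤ/ M)} (λ {i j k} → Group.trans (ℤ/ M) {i} {j} {k})
    (quotient-projection G N-normal) (IsGroupIsomorphism.isGroupHomomorphism (proj₂ G/N≅ℤ/qpᵐ))

  module ψ = IsGroupHomomorphism ψ-isGroupHomomorphism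

  ψ-homo : ∀ x y → ψ (x ∙ y) ≡ ψ x + ψ y mod M
  ψ-homo x y = ≡-mod (ψ.homo x y)

  ψ-cong : ∀ {x y} → x ≈ y → ψ x ≡ ψ y mod M
  ψ-cong x≈y = ≡-mod (ψ.⟦⟧-cong x≈y)

  ψ≡0⇒N : ∀ {x} → ψ x ≡ 0ℤ mod M → N x
  ψ≡0⇒N {x} ψx≡0 = N.resp (trans (∙-congˡ ε⁻¹≈ε) (identityʳ x))
    (IsGroupIsomorphism.injective (proj₂ G/N≅ℤ/qpᵐ) (∣-diff (Mod.trans M ψx≡0 (Mod.sym M (≡-mod ψ.ε-homo)))))
    where open GroupProperties G using (ε⁻¹≈ε)

  G/N-comm : ∀ x y → Group._≈_ (quotient G N-normal) (x ∙ y) (y ∙ x)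
  G/N-comm x y = IsGroupIsomorphism.injective (proj₂ G/N≅ℤ/qpᵐ) (∣-diff (begin
    ψ (x ∙ y)    ≈⟨ ψ-homo x y ⟩
    ψ x + ψ y    ≡⟨ ℤP.+-comm (ψ x) (ψ y) ⟩
    ψ y + ψ x    ≈⟨ ψ-homo y x ⟨
    ψ (y ∙ x)    ∎))
    where open import Relation.Binary.Reasoning.Setoid (Mod.setoid M)

  L₁₂ L : ℕ
  L₁₂ = l₁ ℕ.* l₂
  L = l₂ ^ suc s

  private
    module θ = IsGroupIsomorphism (proj₂ H≅ℤ/l₁l₂)
    module H≅ = ≅-Inverse {G = subgroup G H-sub} {ℤ/ L₁₂} H≅ℤ/l₁l₂
    module ν = IsGroupIsomorphism (proj₂ N≅ℤ/l₂ˢ⁺¹)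

  θ : Σ Carrier H → ℤ
  θ = proj₁ H≅ℤ/l₁l₂

  θ⁻¹ : ℤ → Carrier
  θ⁻¹ z = proj₁ (H≅.from z)

  θ⁻¹-homo : ∀ x y → θ⁻¹ (x + y) ≈ θ⁻¹ x ∙ θ⁻¹ y
  θ⁻¹-homo = H≅.from-homo

  θ⁻¹-injective : ∀ {x y} → θ⁻¹ x ≈ θ⁻¹ y → x ≡ y mod L₁₂
  θ⁻¹-injective {x} {y} θ⁻¹x≈θ⁻¹y = begin
    x                ≈⟨ ≡-mod (H≅.to-from x) ⟨
    θ (H≅.from x)    ≈⟨ ≡-mod (θ.⟦⟧-cong θ⁻¹x≈θ⁻¹y) ⟩
    θ (H≅.from y)    ≈⟨ ≡-mod (H≅.to-from y) ⟩
    y                ∎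
    where open import Relation.Binary.Reasoning.Setoid (Mod.setoid L₁₂)

  ν : Σ Carrier N → ℤ
  ν = proj₁ N≅ℤ/l₂ˢ⁺¹

  χ : ℤ → ℤ
  χ z = ψ (θ⁻¹ z)

  t : ℤ
  t = χ 1ℤ

  χ-linear : ∀ z → χ z ≡ z * t mod M
  χ-linear = additive⇒linear χ (λ x y → Mod.trans M (ψ-cong (θ⁻¹-homo x y)) (ψ-homo (θ⁻¹ x) (θ⁻¹ y)))

  pᵐ∣t : + (p ^ m) ∣ t
  pᵐ∣t = coprime-divisorᶻ t (coprime-^ˡ m p⊥l₁l₂) (∣-trans (∣ᵤ⇒∣ pᵐ∣M) (Mod.≡0⇒∣ M (begin
    + L₁₂ * t     ≈⟨ χ-linear (+ L₁₂) ⟨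
    χ (+ L₁₂)     ≈⟨ ψ-cong (H≅.from-cong (∣-diff (Mod.∣⇒≡0 L₁₂ ∣-refl))) ⟩
    χ 0ℤ          ≈⟨ χ-linear 0ℤ ⟩
    0ℤ * t        ≡⟨ ℤP.*-zeroˡ t ⟩
    0ℤ            ∎)))
    where open import Relation.Binary.Reasoning.Setoid (Mod.setoid M)

  ψ[H]≡0 : ∀ {h} → H h → ψ h ≡ 0ℤ mod p ^ m
  ψ[H]≡0 {h} h∈H = Mod.trans (p ^ m) (≡-mod-∣ pᵐ∣M ψh≡θh*t) (Mod.∣⇒≡0 (p ^ m) (∣n⇒∣m*n (θ (h , h∈H)) pᵐ∣t))
    where
    open import Relation.Binary.Reasoning.Setoid (Mod.setoid M)

    ψh≡θh*t : ψ h ≡ θ (h , h∈H) * t mod M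
    ψh≡θh*t = begin
      ψ h                 ≈⟨ ψ-cong (H≅.from-to (h , h∈H)) ⟨
      χ (θ (h , h∈H))     ≈⟨ χ-linear (θ (h , h∈H)) ⟩
      θ (h , h∈H) * t     ∎

  θ⁻¹q : ℤ → Carrier
  θ⁻¹q z = θ⁻¹ (+ q * z)

  θ⁻¹q∈N : ∀ z → N (θ⁻¹q z)
  θ⁻¹q∈N z = ψ≡0⇒N (Mod.trans M (χ-linear (+ q * z)) (Mod.∣⇒≡0 M M∣qzt))
    where
    M∣qzt : + M ∣ + q * z * t
    M∣qzt = ≡.subst₂ _∣_ (≡.sym (ℤP.pos-* q (p ^ m))) (≡.sym (ℤP.*-assoc (+ q) z t))
              (*-monoʳ-∣ (+ q) (∣n⇒∣m*n z pᵐ∣t))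

  μ : ℤ → ℤ
  μ z = ν (θ⁻¹q z , θ⁻¹q∈N z)

  γ : ℤ
  γ = μ 1ℤ

  μ-linear : ∀ z → μ z ≡ z * γ mod L
  μ-linear = additive⇒linear μ λ x y →
    Mod.trans L (≡-mod (ν.⟦⟧-cong (θ⁻¹q-homo x y))) (≡-mod (ν.∙-homo (θ⁻¹q x , θ⁻¹q∈N x) (θ⁻¹q y , θ⁻¹q∈N y)))
    where
    θ⁻¹q-homo : ∀ x y → θ⁻¹q (x + y) ≈ θ⁻¹q x ∙ θ⁻¹q y
    θ⁻¹q-homo x y = trans (reflexive (≡.cong θ⁻¹ (ℤP.*-distribˡ-+ (+ q) x y))) (θ⁻¹-homo (+ q * x) (+ q * y))

  l₁l₂∤l₁ : ¬ L₁₂ ∣ℕ l₁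
  l₁l₂∤l₁ l₁l₂∣l₁ = ¬prime[1] (≡.subst Prime l₂≡1 l₂-prime)
    where
    l₂≡1 : l₂ ≡ 1
    l₂≡1 = ℕD.∣1⇒≡1 (ℕD.*-cancelˡ-∣ l₁ {{ℕ.>-nonZero l₁>0}}
             (≡.subst (L₁₂ ∣ℕ_) (≡.sym (ℕP.*-identityʳ l₁)) l₁l₂∣l₁))

  -- If l₂ ∣ γ then θ⁻¹q (l₂ˢ) = θ⁻¹ l₁ would be trivial, i.e. l₁l₂ ∣ l₁.
  l₂∤γ : ¬ l₂ ∣ℕ ∣ γ ∣
  l₂∤γ l₂∣γ = l₁l₂∤l₁ (≡.subst (L₁₂ ∣ℕ_) ∣ql₂ˢ∣≡l₁ (∣⇒∣ᵤ (Mod.≡0⇒∣ L₁₂ ql₂ˢ≡0)))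
    where
    l₂ˢ = l₂ ^ s

    L∣l₂ˢγ : + L ∣ + l₂ˢ * γ
    L∣l₂ˢγ = ∣ᵤ⇒∣ (≡.subst₂ _∣ℕ_ (ℕP.*-comm l₂ˢ l₂) (≡.sym (ℤP.abs-* (+ l₂ˢ) γ)) (ℕD.*-monoʳ-∣ l₂ˢ l₂∣γ))

    μl₂ˢ≡μ0 : μ (+ l₂ˢ) ≡ μ 0ℤ mod L
    μl₂ˢ≡μ0 = begin
      μ (+ l₂ˢ)     ≈⟨ μ-linear (+ l₂ˢ) ⟩
      + l₂ˢ * γ     ≈⟨ Mod.∣⇒≡0 L L∣l₂ˢγ ⟩
      0ℤ            ≡⟨ ℤP.*-zeroˡ γ ⟨
      0ℤ * γ        ≈⟨ μ-linear 0ℤ ⟨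
      μ 0ℤ          ∎
      where open import Relation.Binary.Reasoning.Setoid (Mod.setoid L)

    ql₂ˢ≡0 : + q * + l₂ˢ ≡ 0ℤ mod L₁₂
    ql₂ˢ≡0 = Mod.trans L₁₂ (θ⁻¹-injective (ν.injective (∣-diff μl₂ˢ≡μ0))) (Mod.reflexive L₁₂ (ℤP.*-zeroʳ (+ q)))

    ∣ql₂ˢ∣≡l₁ : ∣ + q * + l₂ˢ ∣ ≡ l₁
    ∣ql₂ˢ∣≡l₁ = ≡.trans (≡.cong ∣_∣ (≡.sym (ℤP.pos-* q l₂ˢ))) (≡.sym (ℕD._∣_.equality d))

  N⊆H : ∀ {x} → N x → H x
  N⊆H {x} x∈N = H.resp (ν.injective (∣-diff μz≡νx)) (proj₂ (H≅.from (+ q * z)))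
    where
    γ-invertible : ∃ λ u → u * γ ≡ 1ℤ mod L
    γ-invertible = mod-inverse γ (coprime-^ˡ (suc s) (prime∤⇒coprime l₂-prime l₂∤γ))

    u z : ℤ
    u = proj₁ γ-invertible
    z = ν (x , x∈N) * u

    μz≡νx : μ z ≡ ν (x , x∈N) mod L
    μz≡νx = begin
      μ z                     ≈⟨ μ-linear z ⟩
      ν (x , x∈N) * u * γ     ≡⟨ ℤP.*-assoc (ν (x , x∈N)) u γ ⟩
      ν (x , x∈N) * (u * γ)   ≈⟨ Mod.*-congˡ L (ν (x , x∈N)) (proj₂ γ-invertible) ⟩
      ν (x , x∈N) * 1ℤ        ≡⟨ ℤP.*-identityʳ (ν (x , x∈N)) ⟩
      ν (x , x∈N)             ∎
      where open import Relation.Binary.Reasoning.Setoid (Mod.setoid L)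

  -- |K| = pᵃ annihilates ψ(K) in ℤ/M, and q is prime to p.
  q∣ψ[K] : ∀ {k} → K k → + q ∣ ψ k
  q∣ψ[K] {k} k∈K = coprime-divisorᶻ (ψ k) (q⊥pᵏ a) (∣-trans (∣ᵤ⇒∣ q∣M) (Mod.≡0⇒∣ M pᵃψk≡0))
    where
    a : ℕ
    a = proj₁ P-pgroup

    q∣M : q ∣ℕ M
    q∣M = ℕD.divides (p ^ m) (ℕP.*-comm q (p ^ m))

    ψ∘inclusion : IsGroupHomomorphism (Group.rawGroup (subgroup G K.isSubgroup))
                    (AbelianGroup.rawGroup (ℤ/-abelianGroup M)) (ψ ∘ proj₁)
    ψ∘inclusion = Composition.isGroupHomomorphism
      {G₂ = rawGroup} {G₃ = Group.rawGroup (ℤ/ M)} (λ {i j k} → Group.trans (ℤ/ M) {i} {j} {k})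
      (subgroup-inclusion G K.isSubgroup) ψ-isGroupHomomorphism

    pᵃψk≡0 : + (p ^ a) * ψ k ≡ 0ℤ mod M
    pᵃψk≡0 = ≡.subst (λ w → w ≡ 0ℤ mod M) (×ᴺ≡* M (p ^ a) (ψ k))
      (≡-mod (order-×-homo≈ε {G = subgroup G K.isSubgroup} {A = ℤ/-abelianGroup M} ψ∘inclusion
                (HasOrder-≅ {G = subgroup G K.isSubgroup} {P} K≅P (proj₂ P-pgroup)) (k , k∈K)))

  φ-isGroupHomomorphism : IsGroupHomomorphism rawGroup (Group.rawGroup (ℤ/ (p ^ m))) ψ
  φ-isGroupHomomorphism = Composition.isGroupHomomorphism
    {G₂ = Group.rawGroup (ℤ/ M)} {G₃ = Group.rawGroup (ℤ/ (p ^ m))} (λ {i j k} → Group.trans (ℤ/ (p ^ m)) {i} {j} {k})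
    ψ-isGroupHomomorphism (ℤ/-reduction pᵐ∣M)

  φ-surjective : Surjective _≈_ (Group._≈_ (ℤ/ (p ^ m))) ψ
  φ-surjective y = x , λ {z} z≈x → ∣-diff {ψ z} {y} (≡-mod-∣ pᵐ∣M (Mod.trans M (ψ-cong z≈x) (≡-mod ψx≈y)))
    where
    open IsGroupIsomorphism (proj₂ G/N≅ℤ/qpᵐ) using (surjective)

    x : Carrier
    x = proj₁ (surjective y)

    ψx≈y : Group._≈_ (ℤ/ M) (ψ x) y
    ψx≈y = proj₂ (surjective y) (Group.refl (quotient G N-normal) {x})

  H⊆kerφ : ∀ {h} → H h → Group._≈_ (ℤ/ (p ^ m)) (ψ h) 0ℤ
  H⊆kerφ h∈H = ∣-diff (ψ[H]≡0 h∈H)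

  K∩kerφ≈ε : ∀ {k} → K k → Group._≈_ (ℤ/ (p ^ m)) (ψ k) 0ℤ → k ≈ ε
  K∩kerφ≈ε {k} k∈K ψk≡0 = K∩H≈ε k k∈K (N⊆H (ψ≡0⇒N (Mod.∣⇒≡0 M M∣ψk)))
    where
    M∣ψk : + M ∣ ψ k
    M∣ψk = coprime⇒*∣ᶻ (ψ k) (q⊥pᵏ m) (q∣ψ[K] k∈K) (Mod.≡0⇒∣ (p ^ m) (≡-mod ψk≡0))

lemma1p5 : (p l₁ l₂ s m : ℕ) → Prime p → Prime l₂ → p ≢ l₂ →
           0 < l₁ → ¬ (p ∣ℕ l₁) →
           (d : l₂ ^ s ∣ℕ l₁) → ¬ (l₂ ^ suc s ∣ℕ l₁) →
           (G P : Group 0ℓ 0ℓ) → IsPGroup p P →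
           IsSemidirectProduct G P (ℤ/ (l₁ ℕ.* l₂)) →
           (N : Pred (Group.Carrier G) 0ℓ) → (Nnor : IsNormalSubgroup G N) →
           subgroup G (IsNormalSubgroup.isSubgroup Nnor) ≅ ℤ/ (l₂ ^ suc s) →
           quotient G Nnor ≅ ℤ/ (ℕD._∣_.quotient d ℕ.* p ^ m) →
           G ≅ (ℤ/ (p ^ m) ×ᴳ ℤ/ (l₁ ℕ.* l₂))
lemma1p5 p l₁ l₂ s m p-prime l₂-prime p≢l₂ l₁>0 p∤l₁ d _ G P P-pgroup
         (K , H , K-normal , H-sub , K≅P , H≅ℤ/l₁l₂ , K∩H≈ε , G≈KH) N N-normal N≅ℤ/l₂ˢ⁺¹ G/N≅ℤ/qpᵐ =
  ≅-×ᴳ (complements-commute N-normal G/N-comm N⊆H) {A = ℤ/ (p ^ m)} {C = ℤ/ (l₁ ℕ.* l₂)}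
       φ-isGroupHomomorphism φ-surjective H⊆kerφ K∩kerφ≈ε H≅ℤ/l₁l₂
  where
  open InternalProduct G K-normal H-sub K∩H≈ε G≈KH
  open Proof p l₁ l₂ s m p-prime l₂-prime p≢l₂ l₁>0 p∤l₁ d G P P-pgroup
             K-normal H-sub K≅P H≅ℤ/l₁l₂ K∩H≈ε N-normal N≅ℤ/l₂ˢ⁺¹ G/N≅ℤ/qpᵐ
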